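{- Let $\mathcal{T}$ be a set of binary phylogenetic $X$-trees, let $S$ be a partial tree-child cherry picking sequence and let $k$ be an integer. If $(\mathcal{T},S)$ has a solution of weight at most $k$ and $\mathcal{T}/S$ has no trivial cherries, then the number of distinct cherries of $\mathcal{T}/S$ is at most $4k$.
   Context: A binary phylogenetic $X'$-tree is a rooted tree whose root has out-degree 2, whose internal non-root nodes have in-degree 1 and out-degree 2, and whose leaves are bijectively labelled by $X'$ (or a single node if $|X'|=1$). A pair $\{x,y\}$ is a cherry of a tree if leaves $x,y$ are siblings. For a set of trees $\mathcal{T}$, $\{x,y\}$ is a cherry of $\mathcal{T}$ if it is a cherry of at least one tree in $\mathcal{T}$, and a trivial cherry of $\mathcal{T}$ if moreover it is a cherry of every tree in $\mathcal{T}$ containing both $x$ and $y$. A cherry picking sequence is a sequence $S=\langle (x_1,y_1),\dots,(x_r,y_r),(x_{r+1},-),\dots,(x_s,-)\rangle$ with $x_i,y_i\in X$; $|S|=s$; it is partial if $s=r$. Applying $S$ to a tree $T$: $T^{(0)}=T$, and for $j\le r$, if $\{x_j,y_j\}$ is a cherry of $T^{(j-1)}$ then $T^{(j)}$ is obtained by deleting leaf $x_j$ and suppressing the parent of $y_j$, otherwise $T^{(j)}=T^{(j-1)}$; $T/S=T^{(r)}$, $\mathcal{T}/S=\{T/S:T\in\mathcal{T}\}$. $S$ is a cherry picking sequence for a set $\mathcal{T}$ of $X$-trees if $s>r$, $\{x_1,\dots,x_s\}=X$, and each $T/S$ is a single leaf in $\{x_{r+1},\dots,x_s\}$. $S$ is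 tree-child if $s\le r+1$ and $y_j\ne x_i$ for all $1\le i<j\le s$. The weight is $w(S)=|S|-|X|$. For a partial tree-child cherry picking sequence $S$, a solution of $(\mathcal{T},S)$ is a sequence $S\circ S'$ (concatenation) that is a tree-child cherry picking sequence for $\mathcal{T}$. -}

module Defs where

open import Data.Nat using (ℕ; _≡ᵇ_; _≤_; _<_)
open import Data.Integer as ℤ using (ℤ; +_; _-_)
open import Data.Bool using (Bool; true; false; if_then_else_; _∧_; _∨_)
open import Data.List using (List; []; _∷_; _++_; map; length)
open import Data.List.Membership.Propositional using (_∈_; _∉_)
open import Data.List.Relation.Unary.All using (All)
open import Data.List.Relation.Unary.Unique.Propositional using (Unique)
open import Data.List.Relation.Binary.Permutation.Propositional using (_↭_)
open import Data.Product using (_×_; _,_; proj₁; proj₂; ∃; ∃-syntax)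
open import Data.Unit using (⊤)
open import Relation.Nullary using (¬_)
open import Relation.Binary.PropositionalEquality using (_≡_)
open import Function.Bundles using (_⇔_)

data Tree : Set where
  leaf : ℕ → Tree
  node : Tree → Tree → Tree

leaves : Tree → List ℕ
leaves (leaf x) = x ∷ []
leaves (node l r) = leaves l ++ leaves r

-- T is a binary phylogenetic X-tree: leaf labels are in bijection with X
-- (X is given as a duplicate-free list; the leaf list is a permutation of it).
IsXTree : List ℕ → Tree → Set
IsXTree X T = leaves T ↭ X

data CherryOf (x y : ℕ) : Tree → Set where
  here₁ : CherryOf x y (node (leaf x) (leaf y))
  here₂ : CherryOf x y (node (leaf y) (leaf x))
  left  : ∀ {l r} → CherryOf x y l → CherryOf x y (node l r)
  right : ∀ {l r} → CherryOf x y r → CherryOf x y (node l r)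

CherryOfSet : List Tree → ℕ → ℕ → Set
CherryOfSet 𝒯 x y = ∃[ T ] (T ∈ 𝒯 × CherryOf x y T)

TrivialCherry : List Tree → ℕ → ℕ → Set
TrivialCherry 𝒯 x y =
  CherryOfSet 𝒯 x y ×
  (∀ T → T ∈ 𝒯 → x ∈ leaves T → y ∈ leaves T → CherryOf x y T)

NoTrivialCherries : List Tree → Set
NoTrivialCherries 𝒯 = ∀ x y → ¬ TrivialCherry 𝒯 x y

-- Picking: if {x,y} is a cherry, delete leaf x and suppress the parent of y
-- (the cherry node (x,y) becomes the leaf y); otherwise nothing changes.
isCherryNode : ℕ → ℕ → Tree → Tree → Bool
isCherryNode x y (leaf a) (leaf b) = ((a ≡ᵇ x) ∧ (b ≡ᵇ y)) ∨ ((a ≡ᵇ y) ∧ (b ≡ᵇ x))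
isCherryNode x y _ _ = false

pick : ℕ → ℕ → Tree → Tree
pick x y (leaf z) = leaf z
pick x y (node l r) =
  if isCherryNode x y l r then leaf y else node (pick x y l) (pick x y r)

applySeq : List (ℕ × ℕ) → Tree → Tree
applySeq [] T = T
applySeq ((x , y) ∷ ps) T = applySeq ps (pick x y T)

_/ₛ_ : List Tree → List (ℕ × ℕ) → List Tree
𝒯 /ₛ S = map (applySeq S) 𝒯

-- A cherry picking sequence ⟨(x1,y1),…,(xr,yr),(x_{r+1},-),…,(xs,-)⟩:
-- 'pairs' are the first r elements, 'singles' the remaining x_{r+1..s}.
record CPS : Set where
  constructor cps
  field
    pairs   : List (ℕ × ℕ)
    singles : List ℕ
open CPS public

len : CPS → ℕ
len S = length (pairs S) Data.Nat.+ length (singles S)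

firsts : CPS → List ℕ
firsts S = map proj₁ (pairs S) ++ singles S

IsCPSFor : List Tree → List ℕ → CPS → Set
IsCPSFor 𝒯 X S =
  All (λ p → proj₁ p ∈ X × proj₂ p ∈ X) (pairs S) ×
  All (_∈ X) (singles S) ×
  (1 ≤ length (singles S)) ×
  (∀ z → (z ∈ firsts S) ⇔ (z ∈ X)) ×
  (∀ T → T ∈ 𝒯 → ∃[ z ] (z ∈ singles S × applySeq (pairs S) T ≡ leaf z))

-- y_j ≠ x_i for all i < j (only pairs carry a y_j).
NoEarlier : List ℕ → List (ℕ × ℕ) → Set
NoEarlier seen [] = ⊤
NoEarlier seen ((x , y) ∷ ps) = (y ∉ seen) × NoEarlier (x ∷ seen) ps

IsTreeChild : CPS → Set
IsTreeChild S = (length (singles S) ≤ 1) × NoEarlier [] (pairs S)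

-- A partial sequence (s = r) is just its list of pairs.
IsPartialTreeChild : List (ℕ × ℕ) → Set
IsPartialTreeChild S = IsTreeChild (cps S [])

_∘ₛ_ : List (ℕ × ℕ) → CPS → CPS
S ∘ₛ S' = cps (S ++ pairs S') (singles S')

weight : List ℕ → CPS → ℤ
weight X S = + len S - + length X

HasSolutionOfWeightAtMost : List Tree → List ℕ → List (ℕ × ℕ) → ℤ → Set
HasSolutionOfWeightAtMost 𝒯 X S k =
  ∃[ S' ] (IsCPSFor 𝒯 X (S ∘ₛ S') × IsTreeChild (S ∘ₛ S') × (weight X (S ∘ₛ S') ℤ.≤ k))

-- The number of distinct cherries of 𝒯 is at most m: every duplicate-free list
-- of cherries {x,y} (each written canonically as (x,y) with x < y) has length ≤ m.
NumCherriesAtMost : List Tree → ℤ → Set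
NumCherriesAtMost 𝒯 m =
  ∀ (cs : List (ℕ × ℕ)) → Unique cs →
  All (λ p → (proj₁ p < proj₂ p) × CherryOfSet 𝒯 (proj₁ p) (proj₂ p)) cs →
  + length cs ℤ.≤ m

{-# OPTIONS --safe #-}
-- Let Q be the pairs of the whole solution S ∘ S′ and F its list of first entries, ending with the final
-- leaf z. F has |S ∘ S′| entries and covers X, so at most |F| − |X| ≤ k positions of F repeat an earlier
-- entry. A non-trivial cherry c = {a,b} of 𝒯/S is a cherry of T₁/S but not of T₂/S. In T₁ it persists
-- until a pick (f,g) at some j ≥ |S| picks c itself. If f occurs twice in F, j witnesses c. Otherwise f
-- is removed at j from every tree, so c has become a cherry of T₂ by then: some pick (u,w) at i < j with
-- w ∈ c creates it. In T₁ the leaf u is not removed at i, since {u,w} would then meet c there, so u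
-- occurs twice in F and i witnesses c. Cherries with the same witness of the same kind coincide; for the
-- second kind because two cherries picked through once-occurring leaves and sharing a leaf are equal.
-- Charging a witness to a repeat position (itself, or a later occurrence of its entry) is at most 2-to-1,
-- and there are two kinds of witnesses, so there are at most 4k cherries.
module Submission where

open import Defs
open import Data.Bool using (Bool; true; false)
open import Data.Empty using (⊥; ⊥-elim)
open import Data.Nat as ℕ
  using (ℕ; zero; suc; _+_; _∸_; _≤_; _<_; _≟_; _<?_; _≡ᵇ_; z≤n; s≤s; _≤′_; ≤′-refl; ≤′-step)
open import Data.Nat.Properties
  using ( ≤-refl; ≤-trans; ≤-total; <-trans; <-asym; <-cmp; <-≤-trans; <⇒≤; <⇒≢; <⇒≱
        ; n<1+n; m<n⇒m<1+n; m<1+n⇒m<n∨m≡n; ≤⇒≤′; ≤′⇒≤; +-identityʳ; +-suc; +-monoʳ-≤; *-comm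
        ; m≤n+m; m+n≤o⇒m≤o∸n; ≡ᵇ⇒≡; ≡⇒≡ᵇ )
open import Data.Integer using (ℤ; +_; _-_; _*_; +≤+)
import Data.Integer as ℤ
import Data.Integer.Properties as ℤ
open import Data.List using (List; []; _∷_; _++_; map; length; take; cartesianProduct)
open import Data.List.Properties using (map-cong; length-map; length-++; length-++-≤ˡ; length-removeAt′; take-all)
open import Data.List.Membership.Propositional using (_∈_; _∉_; find)
open import Data.List.Membership.Propositional.Properties
  using (∈-++⁻; ∈-++⁺ˡ; ∈-++⁺ʳ; ∈-map⁻; ∈-cartesianProduct⁺)
open import Data.List.Membership.DecPropositional _≟_ using (_∈?_)
open import Data.List.Relation.Binary.Disjoint.Propositional using (Disjoint)
open import Data.List.Relation.Binary.Permutation.Propositional using (_↭_; ↭-sym; ↭⇒↭ₛ)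
open import Data.List.Relation.Binary.Permutation.Propositional.Properties using (∈-resp-↭)
open import Data.List.Relation.Binary.Subset.Propositional using (_⊆_)
import Data.List.Relation.Binary.Subset.Propositional.Properties as Subset
open import Data.List.Relation.Unary.All as All using (All; []; _∷_)
import Data.List.Relation.Unary.All.Properties as All
open import Data.List.Relation.Unary.Any using (here; there; index; _─_)
open import Data.List.Relation.Unary.Unique.Propositional using (Unique; []; _∷_)
open import Data.Product using (_×_; _,_; proj₁; proj₂; ∃; ∃₂; map₁; map₂)
open import Data.Sum using (_⊎_; inj₁; inj₂; [_,_]′)
open import Data.Unit using (⊤; tt)
open import Function using (id; _∘_)
open import Function.Bundles using (Equivalence)
open import Relation.Binary.Definitions using (tri<; tri≈; tri>)
open import Relation.Binary.PropositionalEquality using (_≡_; _≢_; refl; sym; trans; cong; cong₂; subst; setoid)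
open import Data.List.Relation.Binary.Permutation.Setoid.Properties (setoid ℕ) using (Unique-resp-↭)
open import Relation.Nullary using (¬_; Dec; yes; no; _because_; contradiction)
open import Relation.Nullary.Decidable using (_×-dec_; _⊎-dec_; ¬?; map′; decidable-stable)
open import Relation.Nullary.Reflects using (Reflects; ofʸ; ofⁿ; fromEquivalence; _×-reflects_; _⊎-reflects_)
open import Relation.Unary using (Decidable)

At : {A : Set} → List A → ℕ → A → Set
At []       _       _ = ⊥
At (x ∷ xs) zero    a = x ≡ a
At (x ∷ xs) (suc p) a = At xs p a

module _ {A : Set} where

  At⇒< : ∀ xs p {a : A} → At xs p a → p < length xs
  At⇒< (x ∷ xs) zero    _  = s≤s z≤n
  At⇒< (x ∷ xs) (suc p) at = s≤s (At⇒< xs p at)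

  <⇒At : ∀ (xs : List A) p → p < length xs → ∃ λ a → At xs p a
  <⇒At (x ∷ xs) zero    _         = x , refl
  <⇒At (x ∷ xs) (suc p) (s≤s p<n) = <⇒At xs p p<n

  At-functional : ∀ xs p {a b : A} → At xs p a → At xs p b → a ≡ b
  At-functional (x ∷ xs) zero    refl refl = refl
  At-functional (x ∷ xs) (suc p) at   at′  = At-functional xs p at at′

  At⇒∈ : ∀ xs p {a : A} → At xs p a → a ∈ xs
  At⇒∈ (x ∷ xs) zero    refl = here refl
  At⇒∈ (x ∷ xs) (suc p) at   = there (At⇒∈ xs p at)

  At-++ˡ : ∀ xs {ys} p {a : A} → At xs p a → At (xs ++ ys) p a
  At-++ˡ (x ∷ xs) zero    at = at
  At-++ˡ (x ∷ xs) (suc p) at = At-++ˡ xs p at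

  At-++ʳ : ∀ xs {ys} p {a : A} → At ys p a → At (xs ++ ys) (length xs + p) a
  At-++ʳ []       p at = at
  At-++ʳ (x ∷ xs) p at = At-++ʳ xs p at

  At-map : ∀ {B : Set} (f : A → B) xs p {a} → At xs p a → At (map f xs) p (f a)
  At-map f (x ∷ xs) zero    refl = refl
  At-map f (x ∷ xs) (suc p) at   = At-map f xs p at

At? : ∀ xs p (a : ℕ) → Dec (At xs p a)
At? []       _       _ = no λ ()
At? (x ∷ xs) zero    a = x ≟ a
At? (x ∷ xs) (suc p) a = At? xs p a

EarlierAt : List ℕ → ℕ → ℕ → Set
EarlierAt xs p a = ∃ λ r → r < p × At xs r a

NoneIn : (ℕ → Set) → ℕ → ℕ → Set
NoneIn P lo hi = ∀ p → lo ≤ p → p < hi → ¬ P p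

FirstIn : (ℕ → Set) → ℕ → ℕ → ℕ → Set
FirstIn P lo hi j = lo ≤ j × j < hi × P j × NoneIn P lo j

module _ {P : ℕ → Set} (P? : Decidable P) where

  first-in-range : ∀ {lo hi} → lo ≤ hi → (∃ λ j → FirstIn P lo hi j) ⊎ NoneIn P lo hi
  first-in-range = search ∘ ≤⇒≤′
    where
    search : ∀ {lo hi} → lo ≤′ hi → (∃ λ j → FirstIn P lo hi j) ⊎ NoneIn P lo hi
    search ≤′-refl = inj₂ λ p lo≤p p<lo → contradiction lo≤p (<⇒≱ p<lo)
    search (≤′-step {hi} lo≤′hi) with search lo≤′hi
    ... | inj₁ (j , lo≤j , j<hi , Pj , none) = inj₁ (j , lo≤j , m<n⇒m<1+n j<hi , Pj , none)
    ... | inj₂ none with P? hi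
    ...   | yes Phi  = inj₁ (hi , ≤′⇒≤ lo≤′hi , n<1+n hi , Phi , none)
    ...   | no  ¬Phi = inj₂ λ p lo≤p p<1+hi →
                         [ none p lo≤p , (λ { refl → ¬Phi }) ]′ (m<1+n⇒m<n∨m≡n p<1+hi)

  rising-edge : ∀ {lo hi} → lo ≤ hi → ¬ P lo → P hi →
    ∃ λ i → lo ≤ i × i < hi × ¬ P i × P (suc i)
  rising-edge = rise ∘ ≤⇒≤′
    where
    rise : ∀ {lo hi} → lo ≤′ hi → ¬ P lo → P hi → ∃ λ i → lo ≤ i × i < hi × ¬ P i × P (suc i)
    rise ≤′-refl ¬Plo Plo = contradiction Plo ¬Plo
    rise (≤′-step {hi} lo≤′hi) ¬Plo P1+hi with P? hi
    ... | no ¬Phi = hi , ≤′⇒≤ lo≤′hi , n<1+n hi , ¬Phi , P1+hi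
    ... | yes Phi with rise lo≤′hi ¬Plo Phi
    ...   | i , lo≤i , i<hi , ¬Pi , P1+i = i , lo≤i , m<n⇒m<1+n i<hi , ¬Pi , P1+i

module _ {A : Set} where

  ∈-─⁺ : ∀ {x y : A} {ys} (x∈ys : x ∈ ys) → y ∈ ys → y ≢ x → y ∈ (ys ─ x∈ys)
  ∈-─⁺ (here refl)  (here refl)  y≢x = contradiction refl y≢x
  ∈-─⁺ (here refl)  (there y∈ys) _   = y∈ys
  ∈-─⁺ (there x∈ys) (here refl)  _   = here refl
  ∈-─⁺ (there x∈ys) (there y∈ys) y≢x = there (∈-─⁺ x∈ys y∈ys y≢x)

  length-─ : ∀ {x : A} {ys} (x∈ys : x ∈ ys) → length ys ≡ suc (length (ys ─ x∈ys))
  length-─ {ys = ys} x∈ys = length-removeAt′ ys (index x∈ys)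

module _ {A B : Set} (R : A → B → Set) (R-injective : ∀ {x x′ t} → R x t → R x′ t → x ≡ x′) where

  injection-length-≤ : ∀ {xs} ys → Unique xs → All (λ x → ∃ λ t → t ∈ ys × R x t) xs →
    length xs ≤ length ys
  injection-length-≤ ys [] [] = z≤n
  injection-length-≤ {x ∷ xs} ys (x∉xs ∷ uxs) ((t , t∈ys , Rxt) ∷ images) =
    subst (suc (length xs) ≤_) (sym (length-─ t∈ys))
      (s≤s (injection-length-≤ (ys ─ t∈ys) uxs (All.zipWith avoid-t (x∉xs , images))))
    where
    avoid-t : ∀ {x′} → x ≢ x′ × (∃ λ t′ → t′ ∈ ys × R x′ t′) →
              ∃ λ t′ → t′ ∈ (ys ─ t∈ys) × R x′ t′
    avoid-t (x≢x′ , t′ , t′∈ys , Rx′t′) =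
      t′ , ∈-─⁺ t∈ys t′∈ys (λ { refl → x≢x′ (R-injective Rxt Rx′t′) }) , Rx′t′

Unique-⊆⇒length-≤ : ∀ {A : Set} {xs ys : List A} → Unique xs → xs ⊆ ys → length xs ≤ length ys
Unique-⊆⇒length-≤ {ys = ys} uxs xs⊆ys =
  injection-length-≤ _≡_ (λ x≡t x′≡t → trans x≡t (sym x′≡t)) ys uxs
    (All.tabulate λ x∈xs → _ , xs⊆ys x∈xs , refl)

length-cartesianProduct : ∀ {A B : Set} (xs : List A) (ys : List B) →
  length (cartesianProduct xs ys) ≡ length xs ℕ.* length ys
length-cartesianProduct []       ys = refl
length-cartesianProduct (x ∷ xs) ys =
  trans (length-++ (map (x ,_) ys)) (cong₂ _+_ (length-map (x ,_) ys) (length-cartesianProduct xs ys))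

repeatsFrom : ℕ → List ℕ → List ℕ → List ℕ
repeatsFrom o seen []      = []
repeatsFrom o seen (x ∷ L) with x ∈? seen
... | yes _ = o ∷ repeatsFrom (suc o) (x ∷ seen) L
... | no  _ = repeatsFrom (suc o) (x ∷ seen) L

freshFrom : List ℕ → List ℕ → List ℕ
freshFrom seen []      = []
freshFrom seen (x ∷ L) with x ∈? seen
... | yes _ = freshFrom (x ∷ seen) L
... | no  _ = x ∷ freshFrom (x ∷ seen) L

repeatPositions : List ℕ → List ℕ
repeatPositions = repeatsFrom 0 []

repeatsFrom+freshFrom : ∀ o seen L → length (repeatsFrom o seen L) + length (freshFrom seen L) ≡ length L
repeatsFrom+freshFrom o seen []      = refl
repeatsFrom+freshFrom o seen (x ∷ L) with x ∈? seen
... | yes _ = cong suc (repeatsFrom+freshFrom (suc o) (x ∷ seen) L)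
... | no  _ = trans (+-suc (length (repeatsFrom (suc o) (x ∷ seen) L)) _)
                    (cong suc (repeatsFrom+freshFrom (suc o) (x ∷ seen) L))

∈-freshFrom : ∀ {e} seen L → e ∈ L → e ∉ seen → e ∈ freshFrom seen L
∈-freshFrom seen (x ∷ L) e∈ e∉seen with x ∈? seen
∈-freshFrom seen (x ∷ L) (here refl) e∉seen | yes x∈seen = contradiction x∈seen e∉seen
∈-freshFrom seen (x ∷ L) (there e∈L) e∉seen | yes x∈seen =
  ∈-freshFrom (x ∷ seen) L e∈L λ { (here refl) → e∉seen x∈seen ; (there e∈seen) → e∉seen e∈seen }
∈-freshFrom seen (x ∷ L) (here refl) e∉seen | no _ = here refl
∈-freshFrom {e} seen (x ∷ L) (there e∈L) e∉seen | no _ with e ≟ x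
... | yes refl = here refl
... | no  e≢x  =
  there (∈-freshFrom (x ∷ seen) L e∈L λ { (here e≡x) → e≢x e≡x ; (there e∈seen) → e∉seen e∈seen })

seen-or-earlier-∷ : ∀ {e x seen L d} → e ∈ seen ⊎ EarlierAt (x ∷ L) (suc d) e →
  e ∈ x ∷ seen ⊎ EarlierAt L d e
seen-or-earlier-∷ (inj₁ e∈seen)               = inj₁ (there e∈seen)
seen-or-earlier-∷ (inj₂ (zero , _ , refl))      = inj₁ (here refl)
seen-or-earlier-∷ (inj₂ (suc r , s≤s r<d , at)) = inj₂ (r , r<d , at)

∈-repeatsFrom : ∀ o seen L d {e} → At L d e → e ∈ seen ⊎ EarlierAt L d e → o + d ∈ repeatsFrom o seen L
∈-repeatsFrom o seen (x ∷ L) zero refl seen⊎earlier with x ∈? seen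
... | yes _      = here (+-identityʳ o)
... | no x∉seen  = ⊥-elim ([ x∉seen , (λ { (_ , () , _) }) ]′ seen⊎earlier)
∈-repeatsFrom o seen (x ∷ L) (suc d) at seen⊎earlier rewrite +-suc o d with x ∈? seen
... | yes _ = there (∈-repeatsFrom (suc o) (x ∷ seen) L d at (seen-or-earlier-∷ seen⊎earlier))
... | no  _ = ∈-repeatsFrom (suc o) (x ∷ seen) L d at (seen-or-earlier-∷ seen⊎earlier)

∈-repeatPositions : ∀ L {q e} → At L q e → EarlierAt L q e → q ∈ repeatPositions L
∈-repeatPositions L {q} at earlier = ∈-repeatsFrom 0 [] L q at (inj₂ earlier)

repeatPositions-length : ∀ {X L} → Unique X → X ⊆ L → length (repeatPositions L) + length X ≤ length L
repeatPositions-length {X} {L} uX X⊆L =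
  subst (length (repeatPositions L) + length X ≤_) (repeatsFrom+freshFrom 0 [] L)
    (+-monoʳ-≤ (length (repeatPositions L))
      (Unique-⊆⇒length-≤ uX λ e∈X → ∈-freshFrom [] L (X⊆L e∈X) λ ()))

Distinct : Tree → Set
Distinct (leaf _)   = ⊤
Distinct (node l r) = Distinct l × Distinct r × Disjoint (leaves l) (leaves r)

Unique-++⁻ : ∀ {A : Set} (xs : List A) {ys} → Unique (xs ++ ys) → Unique xs × Unique ys × Disjoint xs ys
Unique-++⁻ []       u           = [] , u , λ { (() , _) }
Unique-++⁻ (x ∷ xs) (x∉ ∷ u) with Unique-++⁻ xs u
... | uxs , uys , disjoint = All.++⁻ˡ xs x∉ ∷ uxs , uys ,
  λ { (here refl , v∈ys)  → All.lookup (All.++⁻ʳ xs x∉) v∈ys refl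
    ; (there v∈xs , v∈ys) → disjoint (v∈xs , v∈ys) }

Unique⇒Distinct : ∀ T → Unique (leaves T) → Distinct T
Unique⇒Distinct (leaf _)   _ = tt
Unique⇒Distinct (node l r) u with Unique-++⁻ (leaves l) u
... | ul , ur , disjoint = Unique⇒Distinct l ul , Unique⇒Distinct r ur , disjoint

_≋_ : ℕ × ℕ → ℕ × ℕ → Set
(a , b) ≋ (c , d) = (a ≡ c × b ≡ d) ⊎ (a ≡ d × b ≡ c)

_∈ₚ_ : ℕ → ℕ × ℕ → Set
e ∈ₚ (a , b) = e ≡ a ⊎ e ≡ b

Overlap : ℕ × ℕ → ℕ × ℕ → Set
Overlap c d = ∃ λ e → e ∈ₚ c × e ∈ₚ d

Ordered : ℕ × ℕ → Set
Ordered (a , b) = a < b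

≋-sym : ∀ {c d} → c ≋ d → d ≋ c
≋-sym {_ , _} {_ , _} (inj₁ (refl , refl)) = inj₁ (refl , refl)
≋-sym {_ , _} {_ , _} (inj₂ (refl , refl)) = inj₂ (refl , refl)

≋-trans : ∀ {c d e} → c ≋ d → d ≋ e → c ≋ e
≋-trans {_ , _} {_ , _} {_ , _} (inj₁ (refl , refl)) d≋e                  = d≋e
≋-trans {_ , _} {_ , _} {_ , _} (inj₂ (refl , refl)) (inj₁ (refl , refl)) = inj₂ (refl , refl)
≋-trans {_ , _} {_ , _} {_ , _} (inj₂ (refl , refl)) (inj₂ (refl , refl)) = inj₁ (refl , refl)

_≋?_ : ∀ c d → Dec (c ≋ d)
(a , b) ≋? (c , d) = (a ≟ c ×-dec b ≟ d) ⊎-dec (a ≟ d ×-dec b ≟ c)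

≋⇒≡ : ∀ {c d} → Ordered c → Ordered d → c ≋ d → c ≡ d
≋⇒≡ {_ , _} {_ , _} _   _   (inj₁ (refl , refl)) = refl
≋⇒≡ {_ , _} {_ , _} a<b b<a (inj₂ (refl , refl)) = ⊥-elim (<-asym a<b b<a)

≋⇒∈ₚ : ∀ {u v c} → (u , v) ≋ c → u ∈ₚ c × v ∈ₚ c
≋⇒∈ₚ {c = _ , _} (inj₁ (refl , refl)) = inj₁ refl , inj₂ refl
≋⇒∈ₚ {c = _ , _} (inj₂ (refl , refl)) = inj₂ refl , inj₁ refl

Overlap-sym : ∀ {c d} → Overlap c d → Overlap d c
Overlap-sym (e , e∈c , e∈d) = e , e∈d , e∈c

¬cherry-leaf : ∀ {a b z} → ¬ CherryOf a b (leaf z)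
¬cherry-leaf ()

cherry-sym : ∀ {a b T} → CherryOf a b T → CherryOf b a T
cherry-sym here₁     = here₂
cherry-sym here₂     = here₁
cherry-sym (left c)  = left (cherry-sym c)
cherry-sym (right c) = right (cherry-sym c)

cherry-≋ : ∀ {a b c d T} → CherryOf a b T → (a , b) ≋ (c , d) → CherryOf c d T
cherry-≋ ab (inj₁ (refl , refl)) = ab
cherry-≋ ab (inj₂ (refl , refl)) = cherry-sym ab

cherry-∈ : ∀ {a b T} → CherryOf a b T → a ∈ leaves T
cherry-∈ here₁                    = here refl
cherry-∈ here₂                    = there (here refl)
cherry-∈             (left c)     = ∈-++⁺ˡ (cherry-∈ c)
cherry-∈ {T = node l _} (right c) = ∈-++⁺ʳ (leaves l) (cherry-∈ c)

cherry-≢ : ∀ {a b T} → Distinct T → CherryOf a b T → a ≢ b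
cherry-≢ (_ , _ , disjoint) here₁     refl = disjoint (here refl , here refl)
cherry-≢ (_ , _ , disjoint) here₂     refl = disjoint (here refl , here refl)
cherry-≢ (dl , _ , _)       (left c)       = cherry-≢ dl c
cherry-≢ (_ , dr , _)       (right c)      = cherry-≢ dr c

sibling-unique : ∀ {a b c T} → Distinct T → CherryOf a b T → CherryOf a c T → b ≡ c
sibling-unique _ here₁ here₁ = refl
sibling-unique _ here₁ here₂ = refl
sibling-unique _ here₂ here₁ = refl
sibling-unique _ here₂ here₂ = refl
sibling-unique (dl , _ , _) (left p)  (left q)  = sibling-unique dl p q
sibling-unique (_ , dr , _) (right p) (right q) = sibling-unique dr p q
sibling-unique (_ , _ , disjoint) (left p)  (right q) = ⊥-elim (disjoint (cherry-∈ p , cherry-∈ q))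
sibling-unique (_ , _ , disjoint) (right p) (left q)  = ⊥-elim (disjoint (cherry-∈ q , cherry-∈ p))
sibling-unique _ here₁ (left ())
sibling-unique _ here₁ (right ())
sibling-unique _ here₂ (left ())
sibling-unique _ here₂ (right ())
sibling-unique _ (left ())  here₁
sibling-unique _ (left ())  here₂
sibling-unique _ (right ()) here₁
sibling-unique _ (right ()) here₂

cherry-overlap : ∀ {a b c d T} → Distinct T → CherryOf a b T → CherryOf c d T →
  Overlap (a , b) (c , d) → (a , b) ≋ (c , d)
cherry-overlap dT p q (_ , inj₁ refl , inj₁ refl) = inj₁ (refl , sibling-unique dT p q)
cherry-overlap dT p q (_ , inj₁ refl , inj₂ refl) = inj₂ (refl , sibling-unique dT p (cherry-sym q))
cherry-overlap dT p q (_ , inj₂ refl , inj₁ refl) = inj₂ (sibling-unique dT (cherry-sym p) q , refl)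
cherry-overlap dT p q (_ , inj₂ refl , inj₂ refl) = inj₁ (sibling-unique dT (cherry-sym p) (cherry-sym q) , refl)

RootCherry : ℕ → ℕ → Tree → Tree → Set
RootCherry x y (leaf a) (leaf b) = (a , b) ≋ (x , y)
RootCherry x y _        _        = ⊥

rootCherry-reflects : ∀ x y l r → Reflects (RootCherry x y l r) (isCherryNode x y l r)
rootCherry-reflects x y (leaf a)   (leaf b)   =
  (≡ᵇ-reflects a x ×-reflects ≡ᵇ-reflects b y) ⊎-reflects (≡ᵇ-reflects a y ×-reflects ≡ᵇ-reflects b x)
  where
  ≡ᵇ-reflects : ∀ m n → Reflects (m ≡ n) (m ≡ᵇ n)
  ≡ᵇ-reflects m n = fromEquivalence (≡ᵇ⇒≡ m n) (≡⇒≡ᵇ m n)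
rootCherry-reflects x y (leaf _)   (node _ _) = ofⁿ λ ()
rootCherry-reflects x y (node _ _) _          = ofⁿ λ ()

rootCherry? : ∀ x y l r → Dec (RootCherry x y l r)
rootCherry? x y l r = isCherryNode x y l r because rootCherry-reflects x y l r

rootCherry⇒cherry : ∀ {x y l r} → RootCherry x y l r → CherryOf x y (node l r)
rootCherry⇒cherry {l = leaf _} {leaf _} (inj₁ (refl , refl)) = here₁
rootCherry⇒cherry {l = leaf _} {leaf _} (inj₂ (refl , refl)) = here₂

rootCherry-leaves : ∀ {x y l r e} → RootCherry x y l r → e ∈ leaves (node l r) → e ∈ₚ (x , y)
rootCherry-leaves {l = leaf _} {leaf _} rc (here refl)         = proj₁ (≋⇒∈ₚ rc)
rootCherry-leaves {l = leaf _} {leaf _} rc (there (here refl)) = proj₂ (≋⇒∈ₚ rc)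

rootCherry-≋ : ∀ {x y a b l r} → RootCherry x y l r → RootCherry a b l r → (x , y) ≋ (a , b)
rootCherry-≋ {l = leaf _} {leaf _} xy ab = ≋-trans (≋-sym xy) ab

rootCherry-childless : ∀ {x y a b l r} → RootCherry x y l r → ¬ (CherryOf a b l ⊎ CherryOf a b r)
rootCherry-childless {l = leaf _} {leaf _} _ (inj₁ ())
rootCherry-childless {l = leaf _} {leaf _} _ (inj₂ ())

rootCherry-pick : ∀ {x y a b l r} → RootCherry a b l r → RootCherry a b (pick x y l) (pick x y r)
rootCherry-pick {l = leaf _} {leaf _} ab = ab

rootCherry⁻ : ∀ {a b L R} → RootCherry a b L R →
  ∃₂ λ u v → L ≡ leaf u × R ≡ leaf v × (u , v) ≋ (a , b)
rootCherry⁻ {L = leaf u} {leaf v} uv = u , v , refl , refl , uv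

cherry-node⁻ : ∀ {a b l r} → CherryOf a b (node l r) → RootCherry a b l r ⊎ CherryOf a b l ⊎ CherryOf a b r
cherry-node⁻ here₁     = inj₁ (inj₁ (refl , refl))
cherry-node⁻ here₂     = inj₁ (inj₂ (refl , refl))
cherry-node⁻ (left c)  = inj₂ (inj₁ c)
cherry-node⁻ (right c) = inj₂ (inj₂ c)

cherry? : ∀ a b T → Dec (CherryOf a b T)
cherry? a b (leaf _)   = no ¬cherry-leaf
cherry? a b (node l r) =
  map′ [ rootCherry⇒cherry , [ left , right ]′ ]′ cherry-node⁻
       (rootCherry? a b l r ⊎-dec (cherry? a b l ⊎-dec cherry? a b r))

pick-⊆ : ∀ x y T → leaves (pick x y T) ⊆ leaves T
pick-⊆ x y (leaf _)   = id
pick-⊆ x y (node l r) with isCherryNode x y l r | rootCherry-reflects x y l r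
... | true  | ofʸ rc = λ { (here refl) → cherry-∈ (cherry-sym (rootCherry⇒cherry rc)) }
... | false | ofⁿ _  = Subset.++⁺ (pick-⊆ x y l) (pick-⊆ x y r)

pick-Distinct : ∀ x y T → Distinct T → Distinct (pick x y T)
pick-Distinct x y (leaf _)   _                  = tt
pick-Distinct x y (node l r) (dl , dr , disjoint) with isCherryNode x y l r | rootCherry-reflects x y l r
... | true  | ofʸ _ = tt
... | false | ofⁿ _ = pick-Distinct x y l dl , pick-Distinct x y r dr ,
                      λ (e∈l , e∈r) → disjoint (pick-⊆ x y l e∈l , pick-⊆ x y r e∈r)

pick-lost : ∀ x y T {e} → e ∈ leaves T → e ∉ leaves (pick x y T) → e ≡ x × CherryOf x y T
pick-lost x y (leaf _)   e∈ e∉ = contradiction e∈ e∉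
pick-lost x y (node l r) e∈ e∉ with isCherryNode x y l r | rootCherry-reflects x y l r
... | true  | ofʸ rc = [ id , (λ e≡y → contradiction (here e≡y) e∉) ]′ (rootCherry-leaves rc e∈) ,
                       rootCherry⇒cherry rc
... | false | ofⁿ _ with ∈-++⁻ (leaves l) e∈
...   | inj₁ e∈l = map₂ left  (pick-lost x y l e∈l (e∉ ∘ ∈-++⁺ˡ))
...   | inj₂ e∈r = map₂ right (pick-lost x y r e∈r (e∉ ∘ ∈-++⁺ʳ (leaves (pick x y l))))

pick-removes : ∀ {x y} T → Distinct T → CherryOf x y T → x ∉ leaves (pick x y T)
pick-removes {x} {y} (node l r) dT@(dl , dr , disjoint) c with isCherryNode x y l r | rootCherry-reflects x y l r
... | true  | ofʸ _   = λ { (here refl) → cherry-≢ dT c refl }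
... | false | ofⁿ ¬rc with cherry-node⁻ c
...   | inj₁ rc        = contradiction rc ¬rc
...   | inj₂ (inj₁ cl) = [ pick-removes l dl cl , (λ x∈r → disjoint (cherry-∈ cl , pick-⊆ x y r x∈r)) ]′
                           ∘ ∈-++⁻ (leaves (pick x y l))
...   | inj₂ (inj₂ cr) = [ (λ x∈l → disjoint (pick-⊆ x y l x∈l , cherry-∈ cr)) , pick-removes r dr cr ]′
                           ∘ ∈-++⁻ (leaves (pick x y l))

pick-preserves : ∀ {a b} x y T → CherryOf a b T → ¬ (x , y) ≋ (a , b) → CherryOf a b (pick x y T)
pick-preserves x y (node l r) c xy≉ab with isCherryNode x y l r | rootCherry-reflects x y l r
... | true  | ofʸ rc = ⊥-elim ([ xy≉ab ∘ rootCherry-≋ rc , rootCherry-childless rc ]′ (cherry-node⁻ c))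
... | false | ofⁿ _ with cherry-node⁻ c
...   | inj₁ ab        = rootCherry⇒cherry (rootCherry-pick ab)
...   | inj₂ (inj₁ cl) = left  (pick-preserves x y l cl xy≉ab)
...   | inj₂ (inj₂ cr) = right (pick-preserves x y r cr xy≉ab)

pick≡leaf : ∀ {a} x y T → pick x y T ≡ leaf a → T ≡ leaf a ⊎ (a ≡ y × CherryOf x y T)
pick≡leaf x y (leaf _)   eq = inj₁ eq
pick≡leaf x y (node l r) eq with isCherryNode x y l r | rootCherry-reflects x y l r
... | true  | ofʸ rc with refl ← eq = inj₂ (refl , rootCherry⇒cherry rc)
... | false | ofⁿ _  with () ← eq

pick-creates-root : ∀ {a b} x y l r → ¬ CherryOf a b (node l r) → RootCherry a b (pick x y l) (pick x y r) →
  CherryOf x y (node l r) × y ∈ₚ (a , b)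
pick-creates-root x y l r ¬ab rc with rootCherry⁻ rc
... | u , v , eqˡ , eqʳ , uv≋ab with pick≡leaf x y l eqˡ | pick≡leaf x y r eqʳ
...   | inj₂ (refl , cl) | _                = left cl  , proj₁ (≋⇒∈ₚ uv≋ab)
...   | inj₁ refl        | inj₂ (refl , cr) = right cr , proj₂ (≋⇒∈ₚ uv≋ab)
...   | inj₁ refl        | inj₁ refl        = contradiction (rootCherry⇒cherry uv≋ab) ¬ab

pick-creates : ∀ {a b} x y T → ¬ CherryOf a b T → CherryOf a b (pick x y T) → CherryOf x y T × y ∈ₚ (a , b)
pick-creates x y (leaf _)   _   c = contradiction c ¬cherry-leaf
pick-creates x y (node l r) ¬ab c with isCherryNode x y l r | rootCherry-reflects x y l r
... | true  | ofʸ _ = contradiction c ¬cherry-leaf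
... | false | ofⁿ _ with cherry-node⁻ c
...   | inj₁ rc        = pick-creates-root x y l r ¬ab rc
...   | inj₂ (inj₁ cl) = map₁ left  (pick-creates x y l (¬ab ∘ left)  cl)
...   | inj₂ (inj₂ cr) = map₁ right (pick-creates x y r (¬ab ∘ right) cr)

applyFirst : ℕ → List (ℕ × ℕ) → Tree → Tree
applyFirst p Q = applySeq (take p Q)

applySeq-Distinct : ∀ ps T → Distinct T → Distinct (applySeq ps T)
applySeq-Distinct []             T dT = dT
applySeq-Distinct ((x , y) ∷ ps) T dT = applySeq-Distinct ps (pick x y T) (pick-Distinct x y T dT)

applyFirst-suc : ∀ Q p T {x y} → At Q p (x , y) → applyFirst (suc p) Q T ≡ pick x y (applyFirst p Q T)
applyFirst-suc (_ ∷ Q)        zero    T refl = refl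
applyFirst-suc ((x , y) ∷ Q) (suc p) T at   = applyFirst-suc Q p (pick x y T) at

applyFirst-suc-⊆ : ∀ Q p T → leaves (applyFirst (suc p) Q T) ⊆ leaves (applyFirst p Q T)
applyFirst-suc-⊆ []            zero    T = id
applyFirst-suc-⊆ []            (suc p) T = id
applyFirst-suc-⊆ ((x , y) ∷ Q) zero    T = pick-⊆ x y T
applyFirst-suc-⊆ ((x , y) ∷ Q) (suc p) T = applyFirst-suc-⊆ Q p (pick x y T)

applyFirst-antitone : ∀ Q T {p q} → p ≤ q → leaves (applyFirst q Q T) ⊆ leaves (applyFirst p Q T)
applyFirst-antitone Q T = antitone ∘ ≤⇒≤′
  where
  antitone : ∀ {p q} → p ≤′ q → leaves (applyFirst q Q T) ⊆ leaves (applyFirst p Q T)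
  antitone ≤′-refl            = id
  antitone (≤′-step {q} p≤′q) = antitone p≤′q ∘ applyFirst-suc-⊆ Q q T

applyFirst-length : ∀ Q T → applyFirst (length Q) Q T ≡ applySeq Q T
applyFirst-length Q T = cong (λ ps → applySeq ps T) (take-all (length Q) Q ≤-refl)

applyFirst-++ : ∀ S P T → applyFirst (length S) (S ++ P) T ≡ applySeq S T
applyFirst-++ []            P T = refl
applyFirst-++ ((x , y) ∷ S) P T = applyFirst-++ S P (pick x y T)

IsXTree⇒Distinct : ∀ {X} T → Unique X → IsXTree X T → Distinct T
IsXTree⇒Distinct T uX leaves↭X = Unique⇒Distinct T (Unique-resp-↭ (↭⇒↭ₛ (↭-sym leaves↭X)) uX)

IsXTree⇒⊆ : ∀ {X} T → IsXTree X T → X ⊆ leaves T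
IsXTree⇒⊆ _ leaves↭X = ∈-resp-↭ (↭-sym leaves↭X)

nontrivial-cherry : ∀ {𝒯 a b} → NoTrivialCherries 𝒯 → CherryOfSet 𝒯 a b →
  ∃ λ T → T ∈ 𝒯 × ¬ CherryOf a b T
nontrivial-cherry {𝒯} {a} {b} no-trivial ab = find (All.¬All⇒Any¬ (cherry? a b) 𝒯 λ all-ab →
  no-trivial a b (ab , λ _ T∈ _ _ → All.lookup all-ab T∈))

-- Q is the whole solution, s₀ = |S| the position where the partial sequence S ends, z the final leaf.
module Charging
  (X : List ℕ) (𝒯 : List Tree) (Q : List (ℕ × ℕ)) (s₀ z : ℕ)
  (distinct : ∀ {T} → T ∈ 𝒯 → Distinct T)
  (X⊆leaves : ∀ {T} → T ∈ 𝒯 → X ⊆ leaves T)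
  (picked∈X : ∀ {p x y} → At Q p (x , y) → x ∈ X)
  (ends-in-z : ∀ {T} → T ∈ 𝒯 → applySeq Q T ≡ leaf z)
  (s₀≤n : s₀ ≤ length Q)
  where

  n : ℕ
  n = length Q

  F : List ℕ
  F = map proj₁ Q ++ z ∷ []

  stage : ℕ → Tree → Tree
  stage p = applyFirst p Q

  length-F : length F ≡ n + 1
  length-F = trans (length-++ (map proj₁ Q)) (cong (_+ 1) (length-map proj₁ Q))

  At-F : ∀ {p x y} → At Q p (x , y) → At F p x
  At-F {p} at = At-++ˡ (map proj₁ Q) p (At-map proj₁ Q p at)

  At-F-end : At F n z
  At-F-end = subst (λ k → At F k z) (trans (+-identityʳ _) (length-map proj₁ Q)) (At-++ʳ (map proj₁ Q) 0 refl)

  stage-Distinct : ∀ {T} p → T ∈ 𝒯 → Distinct (stage p T)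
  stage-Distinct p T∈ = applySeq-Distinct (take p Q) _ (distinct T∈)

  stage-end : ∀ {T} → T ∈ 𝒯 → stage n T ≡ leaf z
  stage-end {T} T∈ = trans (applyFirst-length Q T) (ends-in-z T∈)

  z-survives : ∀ {T p} → T ∈ 𝒯 → p ≤ n → z ∈ leaves (stage p T)
  z-survives {T} T∈ p≤n =
    applyFirst-antitone Q T p≤n (subst (λ t → z ∈ leaves t) (sym (stage-end T∈)) (here refl))

  only-z-survives : ∀ {T e} → T ∈ 𝒯 → e ∈ leaves (stage n T) → e ≡ z
  only-z-survives T∈ e∈ with subst (λ t → _ ∈ leaves t) (stage-end T∈) e∈
  ... | here e≡z = e≡z

  Unrepeated : ℕ → ℕ → Set
  Unrepeated e j = At F j e × (∀ p → At F p e → p ≡ j)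

  Repeated : ℕ → ℕ → Set
  Repeated e j = At F j e × ∃ λ p → p ≢ j × At F p e

  unrepeated-or-repeated : ∀ {e j} → At F j e → Unrepeated e j ⊎ Repeated e j
  unrepeated-or-repeated {e} {j} at with first-in-range (λ p → ¬? (p ≟ j) ×-dec At? F p e) (z≤n {length F})
  ... | inj₁ (p , _ , _ , (p≢j , atp) , _) = inj₂ (at , p , p≢j , atp)
  ... | inj₂ none = inj₁ (at , λ p atp →
    decidable-stable (p ≟ j) λ p≢j → none p z≤n (At⇒< F p atp) (p≢j , atp))

  unrepeated-≢z : ∀ {e j} → Unrepeated e j → j < n → e ≢ z
  unrepeated-≢z (_ , only) j<n refl = <⇒≢ j<n (sym (only n At-F-end))

  leaf-picked : ∀ {T e} → T ∈ 𝒯 → e ∈ X → e ≢ z →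
    ∃₂ λ p y → At Q p (e , y) × CherryOf e y (stage p T)
  leaf-picked {T} {e} T∈ e∈X e≢z
    with rising-edge (λ p → ¬? (e ∈? leaves (stage p T))) z≤n (λ e∉ → e∉ (X⊆leaves T∈ e∈X))
                     (λ e∈ → e≢z (only-z-survives T∈ e∈))
  ... | i , _ , i<n , ¬e∉ , e∉ with <⇒At Q i i<n
  ...   | (x , y) , at
          with pick-lost x y (stage i T) (decidable-stable (e ∈? _) ¬e∉)
                 (subst (λ t → e ∉ leaves t) (applyFirst-suc Q i T at) e∉)
  ...     | refl , c = i , y , at , c

  unrepeated-picked : ∀ {T f g j} → T ∈ 𝒯 → At Q j (f , g) → Unrepeated f j → CherryOf f g (stage j T)
  unrepeated-picked {j = j} T∈ at un@(_ , only)
    with leaf-picked T∈ (picked∈X at) (unrepeated-≢z un (At⇒< Q j at))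
  ... | p , y , atp , c with only p (At-F atp)
  ...   | refl with At-functional Q p atp at
  ...     | refl = c

  Picks : ℕ × ℕ → ℕ → Set
  Picks c p = ∃ λ xy → At Q p xy × xy ≋ c

  picks? : ∀ c p → Dec (Picks c p)
  picks? c p with p <? n
  ... | no p≮n = no λ (_ , at , _) → p≮n (At⇒< Q p at)
  ... | yes p<n with <⇒At Q p p<n
  ...   | xy , at = map′ (λ xy≋c → xy , at , xy≋c)
                         (λ (xy′ , at′ , xy′≋c) → subst (_≋ c) (At-functional Q p at′ at) xy′≋c)
                         (xy ≋? c)

  cherry-persists : ∀ {T a b lo j} → CherryOf a b (stage lo T) → NoneIn (Picks (a , b)) lo j → j ≤ n →
    ∀ {p} → lo ≤ p → p ≤ j → CherryOf a b (stage p T)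
  cherry-persists {T} {a} {b} {lo} {j} c none j≤n lo≤p = persist (≤⇒≤′ lo≤p)
    where
    persist : ∀ {p} → lo ≤′ p → p ≤ j → CherryOf a b (stage p T)
    persist ≤′-refl _ = c
    persist (≤′-step {p} lo≤′p) p<j with <⇒At Q p (<-≤-trans p<j j≤n)
    ... | (x , y) , at =
      subst (CherryOf a b) (sym (applyFirst-suc Q p T at))
        (pick-preserves x y _ (persist lo≤′p (<⇒≤ p<j))
          λ xy≋ab → none p (≤′⇒≤ lo≤′p) p<j ((x , y) , at , xy≋ab))

  record UniquelyPicked (c : ℕ × ℕ) : Set where
    field
      tree         : Tree
      tree∈𝒯       : tree ∈ 𝒯
      pos          : ℕ
      s₀≤pos       : s₀ ≤ pos
      picked       : ℕ × ℕ
      picks        : At Q pos picked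
      picked≋c     : picked ≋ c
      unrepeated   : Unrepeated (proj₁ picked) pos
      cherry-until : ∀ {p} → s₀ ≤ p → p ≤ pos → CherryOf (proj₁ c) (proj₂ c) (stage p tree)
  open UniquelyPicked

  -- In the tree of u₂ both c₁ (whose leaf is removed at pos u₁ in every tree) and c₂ (not yet picked)
  -- are cherries at pos u₁.
  uniquely-picked-earlier : ∀ {c₁ c₂} (u₁ : UniquelyPicked c₁) (u₂ : UniquelyPicked c₂) →
    pos u₁ ≤ pos u₂ → Overlap c₁ c₂ → c₁ ≋ c₂
  uniquely-picked-earlier {_ , _} {_ , _} u₁ u₂ pos₁≤pos₂ =
    cherry-overlap (stage-Distinct (pos u₁) (tree∈𝒯 u₂))
      (cherry-≋ (unrepeated-picked (tree∈𝒯 u₂) (picks u₁) (unrepeated u₁)) (picked≋c u₁))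
      (cherry-until u₂ (s₀≤pos u₁) pos₁≤pos₂)

  uniquely-picked-overlap : ∀ {c₁ c₂} → UniquelyPicked c₁ → UniquelyPicked c₂ → Overlap c₁ c₂ → c₁ ≋ c₂
  uniquely-picked-overlap u₁ u₂ ov with ≤-total (pos u₁) (pos u₂)
  ... | inj₁ pos₁≤pos₂ = uniquely-picked-earlier u₁ u₂ pos₁≤pos₂ ov
  ... | inj₂ pos₂≤pos₁ = ≋-sym (uniquely-picked-earlier u₂ u₁ pos₂≤pos₁ (Overlap-sym ov))

  Created : ℕ × ℕ → ℕ → Set
  Created c i = (∃₂ λ u w → At Q i (u , w) × w ∈ₚ c) × UniquelyPicked c

  Witness : Bool → ℕ × ℕ → ℕ → Set
  Witness true  c j = Picks c j
  Witness false c j = Created c j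

  witness-injective : ∀ kind {j c₁ c₂} → Ordered c₁ → Ordered c₂ →
    Witness kind c₁ j → Witness kind c₂ j → c₁ ≡ c₂
  witness-injective true  {j} o₁ o₂ (xy , at , xy≋c₁) (xy′ , at′ , xy′≋c₂)
    with At-functional Q j at at′
  ... | refl = ≋⇒≡ o₁ o₂ (≋-trans (≋-sym xy≋c₁) xy′≋c₂)
  witness-injective false {j} o₁ o₂ ((u , w , at , w∈c₁) , u₁) ((u′ , w′ , at′ , w′∈c₂) , u₂)
    with At-functional Q j at at′
  ... | refl = ≋⇒≡ o₁ o₂ (uniquely-picked-overlap u₁ u₂ (w , w∈c₁ , w′∈c₂))

  -- A position j whose entry occurs twice in F is charged to a repeat position q of F: to j itself if the
  -- entry occurred before j, and otherwise to another occurrence, from which j is recovered as the first one.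
  Charge : ℕ → Bool → ℕ → Set
  Charge j true  q = q ≡ j
  Charge j false q = ∃ λ e → At F j e × At F q e × ¬ EarlierAt F j e

  charge-injective : ∀ side {j₁ j₂ q} → Charge j₁ side q → Charge j₂ side q → j₁ ≡ j₂
  charge-injective true refl refl = refl
  charge-injective false {j₁} {j₂} {q} (e , at₁ , atq , first₁) (e′ , at₂ , atq′ , first₂)
    with At-functional F q atq atq′
  ... | refl with <-cmp j₁ j₂
  ...   | tri< j₁<j₂ _ _ = contradiction (j₁ , j₁<j₂ , at₁) first₂
  ...   | tri≈ _ j₁≡j₂ _ = j₁≡j₂
  ...   | tri> _ _ j₂<j₁ = contradiction (j₂ , j₂<j₁ , at₂) first₁

  repeated⇒charge : ∀ {e j} → Repeated e j → ∃₂ λ side q → Charge j side q × q ∈ repeatPositions F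
  repeated⇒charge {e} {j} (atj , p , p≢j , atp) with first-in-range (λ r → At? F r e) (z≤n {j})
  ... | inj₁ (r , _ , r<j , atr , _) = true , j , refl , ∈-repeatPositions F atj (r , r<j , atr)
  ... | inj₂ none with <-cmp p j
  ...   | tri< p<j _ _ = contradiction atp (none p z≤n p<j)
  ...   | tri≈ _ p≡j _ = contradiction p≡j p≢j
  ...   | tri> _ _ j<p = false , p , (e , atj , atp , λ (r , r<j , atr) → none r z≤n r<j atr) ,
                         ∈-repeatPositions F atp (j , j<p , atj)

  picked-≢z : ∀ {T i u w} → T ∈ 𝒯 → At Q i (u , w) → CherryOf u w (stage i T) → u ≢ z
  picked-≢z {T} {i} T∈ at uw refl =
    pick-removes (stage i T) (stage-Distinct i T∈) uw
      (subst (λ t → z ∈ leaves t) (applyFirst-suc Q i T at) (z-survives T∈ (At⇒< Q i at)))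

  -- The cherry {u,w} picked at i in T₂ cannot be a cherry of T₁ at i, since there it would meet c in w;
  -- so u is picked in T₁ at another position.
  creator-repeated : ∀ {c T₂ i u w} → (up : UniquelyPicked c) → T₂ ∈ 𝒯 → s₀ ≤ i → i < pos up →
    At Q i (u , w) → w ∈ₚ c → CherryOf u w (stage i T₂) → ¬ CherryOf (proj₁ c) (proj₂ c) (stage i T₂) →
    Repeated u i
  creator-repeated {_ , _} {i = i} {w = w} up T₂∈ s₀≤i i<pos at w∈c uw ¬c
    with leaf-picked (tree∈𝒯 up) (picked∈X at) (picked-≢z T₂∈ at uw)
  ... | p , y , atp , uy = At-F at , p , p≢i , At-F atp
    where
    p≢i : p ≢ i
    p≢i refl with At-functional Q p atp at
    ... | refl = ¬c (cherry-≋ uw (cherry-overlap (stage-Distinct i (tree∈𝒯 up)) uy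
                                   (cherry-until up s₀≤i (<⇒≤ i<pos)) (w , inj₂ refl , w∈c)))

  creation-witness : ∀ {c T₂} → UniquelyPicked c → T₂ ∈ 𝒯 →
    ¬ CherryOf (proj₁ c) (proj₂ c) (stage s₀ T₂) → ∃ λ i → Created c i × ∃ λ e → Repeated e i
  creation-witness {a , b} {T₂} up T₂∈ ¬ab
    with rising-edge (λ p → cherry? a b (stage p T₂)) (s₀≤pos up) ¬ab
           (cherry-≋ (unrepeated-picked T₂∈ (picks up) (unrepeated up)) (picked≋c up))
  ... | i , s₀≤i , i<pos , ¬abᵢ , ab₁₊ᵢ with <⇒At Q i (<-trans i<pos (At⇒< Q (pos up) (picks up)))
  ...   | (u , w) , at
          with pick-creates u w (stage i T₂) ¬abᵢ (subst (CherryOf a b) (applyFirst-suc Q i T₂ at) ab₁₊ᵢ)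
  ...     | uw , w∈ab =
    i , ((u , w , at , w∈ab) , up) , u , creator-repeated up T₂∈ s₀≤i i<pos at w∈ab uw ¬abᵢ

  NontrivialCherry : ℕ × ℕ → Set
  NontrivialCherry (a , b) =
    ∃₂ λ T₁ T₂ → T₁ ∈ 𝒯 × T₂ ∈ 𝒯 × CherryOf a b (stage s₀ T₁) × ¬ CherryOf a b (stage s₀ T₂)

  witness-exists : ∀ {c} → NontrivialCherry c → ∃₂ λ kind j → Witness kind c j × ∃ λ e → Repeated e j
  witness-exists {a , b} (T₁ , T₂ , T₁∈ , T₂∈ , ab₁ , ¬ab₂) with first-in-range (picks? (a , b)) s₀≤n
  ... | inj₂ none =
    contradiction (subst (CherryOf a b) (stage-end T₁∈) (cherry-persists ab₁ none ≤-refl s₀≤n ≤-refl))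
      ¬cherry-leaf
  ... | inj₁ (j , s₀≤j , j<n , ((f , g) , at , fg≋ab) , none) with unrepeated-or-repeated (At-F at)
  ...   | inj₂ rep = true , j , ((f , g) , at , fg≋ab) , f , rep
  ...   | inj₁ un = false , creation-witness uniquely-picked T₂∈ ¬ab₂
    where
    uniquely-picked : UniquelyPicked (a , b)
    uniquely-picked = record
      { tree = T₁ ; tree∈𝒯 = T₁∈ ; pos = j ; s₀≤pos = s₀≤j
      ; picked = f , g ; picks = at ; picked≋c = fg≋ab ; unrepeated = un
      ; cherry-until = cherry-persists ab₁ none (<⇒≤ j<n) }

  Tag : Set
  Tag = ℕ × Bool × Bool

  bools : List Bool
  bools = true ∷ false ∷ []

  ∈-bools : ∀ b → b ∈ bools
  ∈-bools true  = here refl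
  ∈-bools false = there (here refl)

  tags : List Tag
  tags = cartesianProduct (repeatPositions F) (cartesianProduct bools bools)

  Tagged : ℕ × ℕ → Tag → Set
  Tagged c (q , side , kind) = Ordered c × ∃ λ j → Charge j side q × Witness kind c j

  tagged-injective : ∀ {c₁ c₂ t} → Tagged c₁ t → Tagged c₂ t → c₁ ≡ c₂
  tagged-injective {t = _ , side , kind} (o₁ , j₁ , ch₁ , w₁) (o₂ , j₂ , ch₂ , w₂)
    with charge-injective side ch₁ ch₂
  ... | refl = witness-injective kind o₁ o₂ w₁ w₂

  tag : ∀ {c} → Ordered c × NontrivialCherry c → ∃ λ t → t ∈ tags × Tagged c t
  tag (o , nt) with witness-exists nt
  ... | kind , j , w , _ , rep with repeated⇒charge rep
  ...   | side , q , ch , q∈ =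
    (q , side , kind) , ∈-cartesianProduct⁺ q∈ (∈-cartesianProduct⁺ (∈-bools side) (∈-bools kind)) ,
    o , j , ch , w

  repeatPositions-F-length : Unique X → X ⊆ F → length (repeatPositions F) + length X ≤ n + 1
  repeatPositions-F-length uX X⊆F =
    subst (length (repeatPositions F) + length X ≤_) length-F (repeatPositions-length uX X⊆F)

  nontrivial : ∀ {a b} → NoTrivialCherries (map (stage s₀) 𝒯) → CherryOfSet (map (stage s₀) 𝒯) a b →
    NontrivialCherry (a , b)
  nontrivial no-trivial ab@(_ , T₁′∈ , ab₁) with nontrivial-cherry no-trivial ab
  ... | _ , T₂′∈ , ¬ab₂ with ∈-map⁻ (stage s₀) T₁′∈ | ∈-map⁻ (stage s₀) T₂′∈
  ...   | T₁ , T₁∈ , refl | T₂ , T₂∈ , refl = T₁ , T₂ , T₁∈ , T₂∈ , ab₁ , ¬ab₂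

  cherries-≤ : NoTrivialCherries (map (stage s₀) 𝒯) → ∀ cs → Unique cs →
    All (λ c → Ordered c × CherryOfSet (map (stage s₀) 𝒯) (proj₁ c) (proj₂ c)) cs →
    length cs ≤ 4 ℕ.* length (repeatPositions F)
  cherries-≤ no-trivial cs ucs cs-cherries =
    subst (length cs ≤_) length-tags
      (injection-length-≤ Tagged tagged-injective tags ucs (All.map (tag ∘ map₂ (nontrivial no-trivial)) cs-cherries))
    where
    length-tags : length tags ≡ 4 ℕ.* length (repeatPositions F)
    length-tags = trans (length-cartesianProduct (repeatPositions F) _) (*-comm (length (repeatPositions F)) 4)

weight-bound : ∀ {c l x k} m → c ≤ 4 ℕ.* m → m + x ≤ l → + l - + x ℤ.≤ k → + c ℤ.≤ + 4 * k
weight-bound {c} {l} {x} {k} m c≤4m m+x≤l l-x≤k = begin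
  + c       ≤⟨ +≤+ c≤4m ⟩
  + (4 ℕ.* m) ≡⟨ ℤ.pos-* 4 m ⟩
  + 4 * + m ≤⟨ ℤ.*-monoˡ-≤-nonNeg (+ 4) m≤k ⟩
  + 4 * k   ∎
  where
  open ℤ.≤-Reasoning
  l-x≡l∸x : + l - + x ≡ + (l ∸ x)
  l-x≡l∸x = trans (ℤ.m-n≡m⊖n l x) (ℤ.⊖-≥ (≤-trans (m≤n+m x m) m+x≤l))
  m≤k : + m ℤ.≤ k
  m≤k = ℤ.≤-trans (+≤+ (m+n≤o⇒m≤o∸n m m+x≤l)) (subst (ℤ._≤ k) l-x≡l∸x l-x≤k)

proposition9 : (X : List ℕ) → Unique X →
    (𝒯 : List Tree) → All (IsXTree X) 𝒯 →
    (S : List (ℕ × ℕ)) → IsPartialTreeChild S →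
    (k : ℤ) →
    HasSolutionOfWeightAtMost 𝒯 X S k →
    NoTrivialCherries (𝒯 /ₛ S) →
    NumCherriesAtMost (𝒯 /ₛ S) (+ 4 * k)
proposition9 X uX 𝒯 𝒯-X S _ k (cps P [] , (_ , _ , () , _) , _)
proposition9 X uX 𝒯 𝒯-X S _ k (cps P (_ ∷ _ ∷ _) , _ , (s≤s () , _) , _)
proposition9 X uX 𝒯 𝒯-X S _ k (cps P (z ∷ []) , (pairs∈X , _ , _ , firsts⇔X , ends) , _ , weight≤k) =
  subst (λ 𝒯′ → NoTrivialCherries 𝒯′ → NumCherriesAtMost 𝒯′ (+ 4 * k))
        (map-cong (applyFirst-++ S P) 𝒯) λ no-trivial cs ucs cs-cherries →
      weight-bound (length (repeatPositions F)) (cherries-≤ no-trivial cs ucs cs-cherries)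
        (repeatPositions-F-length uX (Equivalence.from (firsts⇔X _))) weight≤k
  where
  ends-in-z : ∀ {T} → T ∈ 𝒯 → applySeq (S ++ P) T ≡ leaf z
  ends-in-z T∈ with ends _ T∈
  ... | _ , here refl , end = end

  open Charging X 𝒯 (S ++ P) (length S) z
    (λ {T} → IsXTree⇒Distinct T uX ∘ All.lookup 𝒯-X) (λ {T} → IsXTree⇒⊆ T ∘ All.lookup 𝒯-X)
    (λ {p} at → proj₁ (All.lookup pairs∈X (At⇒∈ (S ++ P) p at))) ends-in-z (length-++-≤ˡ S)
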